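{- Let $k\ge 2$, let $G_1,\dots,G_k$ be simple graphs and let $G=G_1\otimes G_2\otimes\cdots\otimes G_k$. Then $spec(G,\mathbb{Z}_2)$ is a subgroup of $\mathbb{Z}_2$ if and only if $spec(G_i,\mathbb{Z}_2)$ is a subgroup of $\mathbb{Z}_2$ for some $i\in\{1,\dots,k\}$.
   Context: The tensor product $G\otimes H$ has vertex set $V(G)\times V(H)$, with $(g,h)$ adjacent to $(g',h')$ iff $gg'\in E(G)$ and $hh'\in E(H)$; iterated products are defined by iteration. For an additive abelian group $A$ with identity $0$ and a graph $G$, an $A$-vertex magic labeling of $G$ is a map $l:V(G)\to A\setminus\{0\}$ for which there is $\mu\in A$ (the magic constant) such that $w(v):=\sum_{u\in N_G(v)} l(u)=\mu$ for every $v\in V(G)$. $spec(G,A)$ denotes the set of all magic constants of $A$-vertex magic labelings of $G$ (empty if there is none). -}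

module Defs where

open import Data.Nat using (ℕ; zero; suc; _*_)
open import Data.Fin using (Fin; zero; suc; remQuot; inject₁; fromℕ)
open import Data.Bool using (Bool; true; false; if_then_else_; _∧_)
open import Data.Product using (Σ; _×_; _,_; proj₁; proj₂)
open import Relation.Binary.PropositionalEquality using (_≡_; _≢_; cong; cong₂)
open import Relation.Nullary using (¬_)

ℤ₂ : Set
ℤ₂ = Fin 2

0ℤ₂ : ℤ₂
0ℤ₂ = zero

_+₂_ : ℤ₂ → ℤ₂ → ℤ₂
zero +₂ b = b
suc zero +₂ zero = suc zero
suc zero +₂ suc zero = zero

-₂_ : ℤ₂ → ℤ₂
-₂ a = a

record Graph : Set where
  field
    n       : ℕ
    adj     : Fin n → Fin n → Bool
    sym     : ∀ u v → adj u v ≡ adj v u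
    irrefl  : ∀ v → adj v v ≡ false
open Graph public

-- Tensor product: vertex set V(G) × V(H) encoded as Fin (n G * n H)
-- via remQuot / combine; (g,h) ~ (g',h') iff g ~ g' and h ~ h'.
-- the two coordinates of a vertex of G ⊗ H
πG : (G H : Graph) → Fin (n G * n H) → Fin (n G)
πG G H x = proj₁ (remQuot {n G} (n H) x)

πH : (G H : Graph) → Fin (n G * n H) → Fin (n H)
πH G H x = proj₂ (remQuot {n G} (n H) x)

tensorAdj : (G H : Graph) → Fin (n G * n H) → Fin (n G * n H) → Bool
tensorAdj G H x y = adj G (πG G H x) (πG G H y) ∧ adj H (πH G H x) (πH G H y)

_⊗_ : Graph → Graph → Graph
G ⊗ H = record
  { n      = n G * n H
  ; adj    = tensorAdj G H
  ; sym    = λ x y → cong₂ _∧_ (sym G (πG G H x) (πG G H y)) (sym H (πH G H x) (πH G H y))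
  ; irrefl = λ x → cong (_∧ adj H (πH G H x) (πH G H x)) (irrefl G (πG G H x))
  }

-- Iterated tensor product G₀ ⊗ G₁ ⊗ ⋯ ⊗ Gₖ (left-nested) of k+1 graphs.
⨂ : ∀ k → (Fin (suc k) → Graph) → Graph
⨂ zero    Gs = Gs zero
⨂ (suc k) Gs = ⨂ k (λ i → Gs (inject₁ i)) ⊗ Gs (fromℕ (suc k))

sumℤ₂ : ∀ {m} → (Fin m → ℤ₂) → ℤ₂
sumℤ₂ {zero}  f = 0ℤ₂
sumℤ₂ {suc m} f = f zero +₂ sumℤ₂ (λ i → f (suc i))

weight : (G : Graph) → (Fin (n G) → ℤ₂) → Fin (n G) → ℤ₂
weight G l v = sumℤ₂ (λ u → if adj G v u then l u else 0ℤ₂)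

IsMagicLabeling : (G : Graph) → (Fin (n G) → ℤ₂) → ℤ₂ → Set
IsMagicLabeling G l μ = (∀ v → l v ≢ 0ℤ₂) × (∀ v → weight G l v ≡ μ)

spec : Graph → ℤ₂ → Set
spec G μ = Σ (Fin (n G) → ℤ₂) (λ l → IsMagicLabeling G l μ)

IsSubgroup : (ℤ₂ → Set) → Set
IsSubgroup S = S 0ℤ₂ × (∀ a b → S a → S b → S (a +₂ b)) × (∀ a → S a → S (-₂ a))

{-# OPTIONS --safe #-}
-- Over ℤ₂ the only nonzero label is 1, so the constant labeling 1 is the only candidate and
-- its weight at v is the parity of deg v. Hence spec(G, ℤ₂) is a subgroup (i.e. contains 0)
-- iff every degree of G is even. In G ⊗ H the degree of (g, h) is deg g · deg h, so its parity
-- is the product of the parities: the product has all degrees even iff some factor does, since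
-- an odd-degree vertex in every factor yields an odd-degree vertex of the product.
module Submission where

open import Defs hiding (sym)
open import Data.Nat using (ℕ; zero; suc; _+_; _*_)
open import Data.Fin using (Fin; zero; suc; combine; _↑ˡ_; _↑ʳ_; inject₁; fromℕ)
open import Data.Fin.Properties using (remQuot-combine; all?; any?; ¬∀⟶∃¬)
open import Data.Fin.Relation.Unary.Top using (view; ‵fromℕ; ‵inject₁)
open import Data.Bool using (Bool; true; false; if_then_else_; _∧_)
open import Data.Product using (Σ; _×_; _,_; proj₁; proj₂)
open import Data.Empty using (⊥-elim)
open import Function using (_∘_)
open import Relation.Binary.PropositionalEquality using (_≡_; _≢_; refl; sym; trans; cong; cong₂; module ≡-Reasoning)
open import Relation.Nullary using (¬_; Dec; yes; no)
import Data.Fin as Fin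

open ≡-Reasoning

1ℤ₂ : ℤ₂
1ℤ₂ = suc zero

1ℤ₂≢0ℤ₂ : 1ℤ₂ ≢ 0ℤ₂
1ℤ₂≢0ℤ₂ ()

≢0ℤ₂⇒≡1ℤ₂ : ∀ {a} → a ≢ 0ℤ₂ → a ≡ 1ℤ₂
≢0ℤ₂⇒≡1ℤ₂ {zero}     a≢0 = ⊥-elim (a≢0 refl)
≢0ℤ₂⇒≡1ℤ₂ {suc zero} _   = refl

_*₂_ : ℤ₂ → ℤ₂ → ℤ₂
zero     *₂ b = zero
suc zero *₂ b = b

+₂-assoc : ∀ a b c → (a +₂ b) +₂ c ≡ a +₂ (b +₂ c)
+₂-assoc zero       b          c          = refl
+₂-assoc (suc zero) zero       c          = refl
+₂-assoc (suc zero) (suc zero) zero       = refl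
+₂-assoc (suc zero) (suc zero) (suc zero) = refl

*₂-zeroʳ : ∀ a → a *₂ 0ℤ₂ ≡ 0ℤ₂
*₂-zeroʳ zero       = refl
*₂-zeroʳ (suc zero) = refl

*₂-distribˡ-+₂ : ∀ a b c → a *₂ (b +₂ c) ≡ (a *₂ b) +₂ (a *₂ c)
*₂-distribˡ-+₂ zero       b c = refl
*₂-distribˡ-+₂ (suc zero) b c = refl

*₂-distribʳ-+₂ : ∀ a b c → (a +₂ b) *₂ c ≡ (a *₂ c) +₂ (b *₂ c)
*₂-distribʳ-+₂ zero       b          c          = refl
*₂-distribʳ-+₂ (suc zero) zero       zero       = refl
*₂-distribʳ-+₂ (suc zero) zero       (suc zero) = refl
*₂-distribʳ-+₂ (suc zero) (suc zero) zero       = refl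
*₂-distribʳ-+₂ (suc zero) (suc zero) (suc zero) = refl

fromBool : Bool → ℤ₂
fromBool b = if b then 1ℤ₂ else 0ℤ₂

fromBool-∧ : ∀ a b → fromBool (a ∧ b) ≡ fromBool a *₂ fromBool b
fromBool-∧ true  b = refl
fromBool-∧ false b = refl

sumℤ₂-cong : ∀ {m} {f g : Fin m → ℤ₂} → (∀ i → f i ≡ g i) → sumℤ₂ f ≡ sumℤ₂ g
sumℤ₂-cong {zero}  f≗g = refl
sumℤ₂-cong {suc m} f≗g = cong₂ _+₂_ (f≗g zero) (sumℤ₂-cong (f≗g ∘ suc))

sumℤ₂-↑ : ∀ m {p} (f : Fin (m + p) → ℤ₂) →
          sumℤ₂ f ≡ sumℤ₂ (λ i → f (i ↑ˡ p)) +₂ sumℤ₂ (λ j → f (m ↑ʳ j))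
sumℤ₂-↑ zero    f = refl
sumℤ₂-↑ (suc m) f = trans (cong (f zero +₂_) (sumℤ₂-↑ m (f ∘ suc))) (sym (+₂-assoc (f zero) _ _))

sumℤ₂-combine : ∀ m n (f : Fin (m * n) → ℤ₂) →
                sumℤ₂ f ≡ sumℤ₂ (λ i → sumℤ₂ (λ j → f (combine {m} {n} i j)))
sumℤ₂-combine zero    n f = refl
sumℤ₂-combine (suc m) n f =
  trans (sumℤ₂-↑ n f) (cong (sumℤ₂ (λ j → f (j ↑ˡ (m * n))) +₂_) (sumℤ₂-combine m n (λ x → f (n ↑ʳ x))))

*₂-distribˡ-sumℤ₂ : ∀ {m} c (f : Fin m → ℤ₂) → c *₂ sumℤ₂ f ≡ sumℤ₂ (λ i → c *₂ f i)
*₂-distribˡ-sumℤ₂ {zero}  c f = *₂-zeroʳ c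
*₂-distribˡ-sumℤ₂ {suc m} c f =
  trans (*₂-distribˡ-+₂ c (f zero) _) (cong ((c *₂ f zero) +₂_) (*₂-distribˡ-sumℤ₂ c (f ∘ suc)))

*₂-distribʳ-sumℤ₂ : ∀ {m} c (f : Fin m → ℤ₂) → sumℤ₂ f *₂ c ≡ sumℤ₂ (λ i → f i *₂ c)
*₂-distribʳ-sumℤ₂ {zero}  c f = refl
*₂-distribʳ-sumℤ₂ {suc m} c f =
  trans (*₂-distribʳ-+₂ (f zero) _ c) (cong ((f zero *₂ c) +₂_) (*₂-distribʳ-sumℤ₂ c (f ∘ suc)))

degree₂ : (G : Graph) → Fin (n G) → ℤ₂
degree₂ G v = weight G (λ _ → 1ℤ₂) v

EvenDegrees : Graph → Set
EvenDegrees G = ∀ v → degree₂ G v ≡ 0ℤ₂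

HasOddVertex : Graph → Set
HasOddVertex G = Σ (Fin (n G)) (λ v → degree₂ G v ≡ 1ℤ₂)

evenDegrees? : ∀ G → Dec (EvenDegrees G)
evenDegrees? G = all? (λ v → degree₂ G v Fin.≟ 0ℤ₂)

¬evenDegrees⇒hasOddVertex : ∀ G → ¬ EvenDegrees G → HasOddVertex G
¬evenDegrees⇒hasOddVertex G ¬even
  with ¬∀⟶∃¬ (n G) (λ v → degree₂ G v ≡ 0ℤ₂) (λ v → degree₂ G v Fin.≟ 0ℤ₂) ¬even
... | v , odd = v , ≢0ℤ₂⇒≡1ℤ₂ odd

hasOddVertex⇒¬evenDegrees : ∀ G → HasOddVertex G → ¬ EvenDegrees G
hasOddVertex⇒¬evenDegrees G (v , odd) even = 1ℤ₂≢0ℤ₂ (trans (sym odd) (even v))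

weight-nonzero : ∀ G {l} → (∀ v → l v ≢ 0ℤ₂) → ∀ v → weight G l v ≡ degree₂ G v
weight-nonzero G l≢0 v = sumℤ₂-cong (λ u → cong (if adj G v u then_else 0ℤ₂) (≢0ℤ₂⇒≡1ℤ₂ (l≢0 u)))

spec⇒degree₂≡ : ∀ G {μ} → spec G μ → ∀ v → degree₂ G v ≡ μ
spec⇒degree₂≡ G (l , l≢0 , magic) v = trans (sym (weight-nonzero G l≢0 v)) (magic v)

degree₂≡⇒spec : ∀ G {μ} → (∀ v → degree₂ G v ≡ μ) → spec G μ
degree₂≡⇒spec G deg≡μ = (λ _ → 1ℤ₂) , (λ _ ()) , deg≡μ

subgroup⇒evenDegrees : ∀ G → IsSubgroup (spec G) → EvenDegrees G
subgroup⇒evenDegrees G (spec0 , _) = spec⇒degree₂≡ G spec0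

evenDegrees⇒subgroup : ∀ G → EvenDegrees G → IsSubgroup (spec G)
evenDegrees⇒subgroup G even = degree₂≡⇒spec G even , +-closed , λ _ spec-a → spec-a
  where
  +-closed : ∀ a b → spec G a → spec G b → spec G (a +₂ b)
  +-closed a b spec-a spec-b = degree₂≡⇒spec G λ v → begin
    degree₂ G v  ≡⟨ even v ⟩
    0ℤ₂ +₂ 0ℤ₂   ≡⟨ cong₂ _+₂_ (0≡μ spec-a v) (0≡μ spec-b v) ⟩
    a +₂ b       ∎
    where
    0≡μ : ∀ {μ} → spec G μ → ∀ v → 0ℤ₂ ≡ μ
    0≡μ spec-μ v = trans (sym (even v)) (spec⇒degree₂≡ G spec-μ v)

πG-combine : ∀ G H g h → πG G H (combine g h) ≡ g
πG-combine G H g h = cong proj₁ (remQuot-combine {n G} {n H} g h)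

πH-combine : ∀ G H g h → πH G H (combine g h) ≡ h
πH-combine G H g h = cong proj₂ (remQuot-combine {n G} {n H} g h)

tensorAdj-combine : ∀ G H x g h →
  tensorAdj G H x (combine g h) ≡ adj G (πG G H x) g ∧ adj H (πH G H x) h
tensorAdj-combine G H x g h =
  cong₂ (λ g′ h′ → adj G (πG G H x) g′ ∧ adj H (πH G H x) h′) (πG-combine G H g h) (πH-combine G H g h)

degree₂-⊗ : ∀ G H x → degree₂ (G ⊗ H) x ≡ degree₂ G (πG G H x) *₂ degree₂ H (πH G H x)
degree₂-⊗ G H x = begin
  degree₂ (G ⊗ H) x
    ≡⟨ sumℤ₂-combine (n G) (n H) _ ⟩
  sumℤ₂ (λ g → sumℤ₂ (λ h → fromBool (tensorAdj G H x (combine {n G} {n H} g h))))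
    ≡⟨ sumℤ₂-cong {n G} (λ g → sumℤ₂-cong {n H} (λ h →
         trans (cong fromBool (tensorAdj-combine G H x g h)) (fromBool-∧ (adj G gx g) (adj H hx h)))) ⟩
  sumℤ₂ (λ g → sumℤ₂ (λ h → fromBool (adj G gx g) *₂ fromBool (adj H hx h)))
    ≡⟨ sumℤ₂-cong {n G} (λ g → sym (*₂-distribˡ-sumℤ₂ (fromBool (adj G gx g)) (fromBool ∘ adj H hx))) ⟩
  sumℤ₂ (λ g → fromBool (adj G gx g) *₂ degree₂ H hx)
    ≡⟨ sym (*₂-distribʳ-sumℤ₂ (degree₂ H hx) (fromBool ∘ adj G gx)) ⟩
  degree₂ G gx *₂ degree₂ H hx
    ∎
  where
  gx = πG G H x
  hx = πH G H x

⊗-evenDegreesˡ : ∀ G H → EvenDegrees G → EvenDegrees (G ⊗ H)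
⊗-evenDegreesˡ G H even x = trans (degree₂-⊗ G H x) (cong (_*₂ degree₂ H (πH G H x)) (even (πG G H x)))

⊗-evenDegreesʳ : ∀ G H → EvenDegrees H → EvenDegrees (G ⊗ H)
⊗-evenDegreesʳ G H even x = begin
  degree₂ (G ⊗ H) x
    ≡⟨ degree₂-⊗ G H x ⟩
  degree₂ G (πG G H x) *₂ degree₂ H (πH G H x)
    ≡⟨ cong (degree₂ G (πG G H x) *₂_) (even (πH G H x)) ⟩
  degree₂ G (πG G H x) *₂ 0ℤ₂
    ≡⟨ *₂-zeroʳ _ ⟩
  0ℤ₂
    ∎

⊗-hasOddVertex : ∀ G H → HasOddVertex G → HasOddVertex H → HasOddVertex (G ⊗ H)
⊗-hasOddVertex G H (g , odd-g) (h , odd-h) = combine g h , (begin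
  degree₂ (G ⊗ H) (combine g h)
    ≡⟨ degree₂-⊗ G H (combine g h) ⟩
  degree₂ G (πG G H (combine g h)) *₂ degree₂ H (πH G H (combine g h))
    ≡⟨ cong₂ (λ g′ h′ → degree₂ G g′ *₂ degree₂ H h′) (πG-combine G H g h) (πH-combine G H g h) ⟩
  degree₂ G g *₂ degree₂ H h
    ≡⟨ cong₂ _*₂_ odd-g odd-h ⟩
  1ℤ₂
    ∎)

⨂-evenDegrees : ∀ k (Gs : Fin (suc k) → Graph) i → EvenDegrees (Gs i) → EvenDegrees (⨂ k Gs)
⨂-evenDegrees zero    Gs zero even = even
⨂-evenDegrees (suc k) Gs i    even with view i
... | ‵fromℕ     = ⊗-evenDegreesʳ (⨂ k (Gs ∘ inject₁)) (Gs i) even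
... | ‵inject₁ j = ⊗-evenDegreesˡ (⨂ k (Gs ∘ inject₁)) (Gs (fromℕ (suc k))) (⨂-evenDegrees k (Gs ∘ inject₁) j even)

⨂-hasOddVertex : ∀ k (Gs : Fin (suc k) → Graph) → (∀ i → HasOddVertex (Gs i)) → HasOddVertex (⨂ k Gs)
⨂-hasOddVertex zero    Gs odd = odd zero
⨂-hasOddVertex (suc k) Gs odd =
  ⊗-hasOddVertex (⨂ k (Gs ∘ inject₁)) (Gs (fromℕ (suc k)))
    (⨂-hasOddVertex k (Gs ∘ inject₁) (odd ∘ inject₁)) (odd (fromℕ (suc k)))

mainTheorem5 : (k : ℕ) → (Gs : Fin (suc (suc k)) → Graph) →
    (IsSubgroup (spec (⨂ (suc k) Gs)) → Σ (Fin (suc (suc k))) (λ i → IsSubgroup (spec (Gs i))))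
    × (Σ (Fin (suc (suc k))) (λ i → IsSubgroup (spec (Gs i))) → IsSubgroup (spec (⨂ (suc k) Gs)))
mainTheorem5 k Gs = factor-subgroup , product-subgroup
  where
  G = ⨂ (suc k) Gs

  product-subgroup : Σ (Fin (suc (suc k))) (λ i → IsSubgroup (spec (Gs i))) → IsSubgroup (spec G)
  product-subgroup (i , sub) =
    evenDegrees⇒subgroup G (⨂-evenDegrees (suc k) Gs i (subgroup⇒evenDegrees (Gs i) sub))

  factor-subgroup : IsSubgroup (spec G) → Σ (Fin (suc (suc k))) (λ i → IsSubgroup (spec (Gs i)))
  factor-subgroup sub with any? (λ i → evenDegrees? (Gs i))
  ... | yes (i , even) = i , evenDegrees⇒subgroup (Gs i) even
  ... | no ¬even = ⊥-elim (hasOddVertex⇒¬evenDegrees G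
         (⨂-hasOddVertex (suc k) Gs (λ i → ¬evenDegrees⇒hasOddVertex (Gs i) (λ even → ¬even (i , even))))
         (subgroup⇒evenDegrees G sub))
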